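{- For every query $\mathcal Q$: $\mathcal Q\in\mathrm{DynFO}$ if and only if $\mathcal Q\in\mathrm{DynFO}^{\wedge}$.
   Context: Dynamic complexity setting. A dynamic schema is a pair $(\tau_{in},\tau_{aux})$ of disjoint finite relational schemas; $\tau=\tau_{in}\cup\tau_{aux}$. A modification is $\mathrm{ins}_S(\vec a)$ or $\mathrm{del}_S(\vec a)$ for $S\in\tau_{in}$ and a tuple $\vec a$ of the arity of $S$. An update program assigns to every $R\in\tau_{aux}$ and every $\delta\in\{\mathrm{ins}_S,\mathrm{del}_S : S\in\tau_{in}\}$ a first-order formula $\phi^R_\delta(\vec u;\vec x)$ over $\tau$ (with equality), $|\vec u|$ = arity of $S$, $|\vec x|$ = arity of $R$. A state is $(D,\mathcal I,\mathcal A)$ with finite domain $D$, a $\tau_{in}$-database $\mathcal I$ and a $\tau_{aux}$-database $\mathcal A$ over $D$. Applying $\delta(\vec a)$ to a state $\mathcal S$ gives $(D,\delta(\mathcal I),\mathcal A')$ where $R^{\mathcal A'}=\{\vec b:\mathcal S\models\phi^R_\delta(\vec a;\vec b)\}$. A dynamic program is $(P,\mathrm{Init},Q)$ with $P$ an update program, $\mathrm{Init}$ an arbitrary mapping from $\tau_{in}$-databases to $\tau_{aux}$-databases over the same domain, and $Q\in\tau_{aux}$. It maintains a query $\mathcal Q$ if for every $\tau_{in}$-database $\mathcal D$ with domain $D$ and every finite modification sequence $\alpha$, $\mathcal Q(\alpha(\mathcal D))$ equals the interpretation of $Q$ in the state obtained from $(D,\mathcal D,\mathrm{Init}(\mathcal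 D))$ by applying $\alpha$. For a class $\mathcal C$ of formulas, $\mathrm{Dyn}\mathcal C$ is the class of queries maintained by some dynamic program all of whose update formulas lie in $\mathcal C$. FO = all first-order formulas; FO$^\wedge$ = first-order formulas in prenex normal form whose quantifier-free part is a conjunction of atoms. -}

module Defs where

open import Data.Nat using (ℕ; suc; _+_)
open import Data.Fin using (Fin) renaming (_≟_ to _≟ᶠ_)
open import Data.Vec using (Vec; lookup; map; _++_)
open import Data.Vec.Properties using (≡-dec)
open import Data.List using (List; []; _∷_; allFin)
open import Data.Bool.ListAction using (any; all)
open import Data.Bool using (Bool; true; false; _∧_; _∨_; not; if_then_else_)
open import Data.Sum using (_⊎_; inj₁; inj₂; [_,_])
open import Data.Product using (Σ; _×_; _,_)
open import Data.Unit using (⊤)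
open import Relation.Nullary using (Dec; yes; no)
open import Relation.Nullary.Decidable using (⌊_⌋)
open import Relation.Binary.PropositionalEquality using (_≡_; refl; subst)

-- Variables are de Bruijn indices: a
-- formula of type  Formula Sym ar v  has its free variables among Fin v.

data Formula (Sym : Set) (ar : Sym → ℕ) : ℕ → Set where
  rel  : ∀ {v} (R : Sym) → Vec (Fin v) (ar R) → Formula Sym ar v
  eq   : ∀ {v} → Fin v → Fin v → Formula Sym ar v
  tt   : ∀ {v} → Formula Sym ar v
  ff   : ∀ {v} → Formula Sym ar v
  neg  : ∀ {v} → Formula Sym ar v → Formula Sym ar v
  conj : ∀ {v} → Formula Sym ar v → Formula Sym ar v → Formula Sym ar v
  disj : ∀ {v} → Formula Sym ar v → Formula Sym ar v → Formula Sym ar v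
  ex   : ∀ {v} → Formula Sym ar (suc v) → Formula Sym ar v
  fa   : ∀ {v} → Formula Sym ar (suc v) → Formula Sym ar v

Rel : ℕ → ℕ → Set
Rel n k = Vec (Fin n) k → Bool

Database : (Sym : Set) → (Sym → ℕ) → ℕ → Set
Database Sym ar n = (s : Sym) → Rel n (ar s)

eval : ∀ {Sym ar n v} → Formula Sym ar v → Database Sym ar n → Vec (Fin n) v → Bool
eval (rel R xs) 𝒟 env = 𝒟 R (map (lookup env) xs)
eval (eq x y)   𝒟 env = ⌊ lookup env x ≟ᶠ lookup env y ⌋
eval tt         𝒟 env = true
eval ff         𝒟 env = false
eval (neg φ)    𝒟 env = not (eval φ 𝒟 env)
eval (conj φ ψ) 𝒟 env = eval φ 𝒟 env ∧ eval ψ 𝒟 env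
eval (disj φ ψ) 𝒟 env = eval φ 𝒟 env ∨ eval ψ 𝒟 env
eval {n = n} (ex φ) 𝒟 env = any (λ d → eval φ 𝒟 (d Data.Vec.∷ env)) (allFin n)
eval {n = n} (fa φ) 𝒟 env = all (λ d → eval φ 𝒟 (d Data.Vec.∷ env)) (allFin n)

FormulaClass : Set₁
FormulaClass = ∀ {Sym : Set} {ar : Sym → ℕ} {v : ℕ} → Formula Sym ar v → Set

FO : FormulaClass
FO _ = ⊤

data IsAtom {Sym : Set} {ar : Sym → ℕ} {v : ℕ} : Formula Sym ar v → Set where
  rel-atom : ∀ R xs → IsAtom (rel R xs)
  eq-atom  : ∀ x y → IsAtom (eq x y)

data IsConjOfAtoms {Sym : Set} {ar : Sym → ℕ} {v : ℕ} : Formula Sym ar v → Set where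
  atom : ∀ {φ} → IsAtom φ → IsConjOfAtoms φ
  and  : ∀ {φ ψ} → IsConjOfAtoms φ → IsConjOfAtoms ψ → IsConjOfAtoms (conj φ ψ)

data FOConj {Sym : Set} {ar : Sym → ℕ} : {v : ℕ} → Formula Sym ar v → Set where
  matrix : ∀ {v} {φ : Formula Sym ar v} → IsConjOfAtoms φ → FOConj φ
  ex-pre : ∀ {v} {φ : Formula Sym ar (suc v)} → FOConj φ → FOConj (ex φ)
  fa-pre : ∀ {v} {φ : Formula Sym ar (suc v)} → FOConj φ → FOConj (fa φ)

FO∧ : FormulaClass
FO∧ φ = FOConj φ

Query : (nin : ℕ) → (Fin nin → ℕ) → ℕ → Set
Query nin arIn k = ∀ n → Database (Fin nin) arIn n → Rel n k

data ModKind : Set where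
  ins del : ModKind

record Modification (nin : ℕ) (arIn : Fin nin → ℕ) (n : ℕ) : Set where
  constructor mod
  field
    kind  : ModKind
    S     : Fin nin
    tuple : Vec (Fin n) (arIn S)

_≟ᵛ_ : ∀ {n k} (a b : Vec (Fin n) k) → Dec (a ≡ b)
_≟ᵛ_ = ≡-dec _≟ᶠ_

applyInput : ∀ {nin arIn n} → Modification nin arIn n → Database (Fin nin) arIn n → Database (Fin nin) arIn n
applyInput (mod ins S a) I S′ b with S′ ≟ᶠ S
... | yes refl = if ⌊ b ≟ᵛ a ⌋ then true else I S b
... | no _     = I S′ b
applyInput (mod del S a) I S′ b with S′ ≟ᶠ S
... | yes refl = if ⌊ b ≟ᵛ a ⌋ then false else I S b
... | no _     = I S′ b

applyInputSeq : ∀ {nin arIn n} → List (Modification nin arIn n) → Database (Fin nin) arIn n → Database (Fin nin) arIn n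
applyInputSeq []      I = I
applyInputSeq (m ∷ α) I = applyInputSeq α (applyInput m I)

TauSym : ℕ → ℕ → Set
TauSym nin naux = Fin nin ⊎ Fin naux

tauAr : ∀ {nin naux} → (Fin nin → ℕ) → (Fin naux → ℕ) → TauSym nin naux → ℕ
tauAr arIn arAux = [ arIn , arAux ]

-- φ^R_δ(u ; x): free variables Fin (arIn S + arAux R); the first arIn S
-- variables are u, the remaining arAux R are x.
UpdateProgram : (nin : ℕ) (arIn : Fin nin → ℕ) (naux : ℕ) (arAux : Fin naux → ℕ) → Set
UpdateProgram nin arIn naux arAux =
  (R : Fin naux) → ModKind → (S : Fin nin) → Formula (TauSym nin naux) (tauAr arIn arAux) (arIn S + arAux R)

State : (nin : ℕ) (arIn : Fin nin → ℕ) (naux : ℕ) (arAux : Fin naux → ℕ) → ℕ → Set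
State nin arIn naux arAux n = Database (Fin nin) arIn n × Database (Fin naux) arAux n

stateDB : ∀ {nin arIn naux arAux n} → State nin arIn naux arAux n → Database (TauSym nin naux) (tauAr arIn arAux) n
stateDB (I , A) (inj₁ S) = I S
stateDB (I , A) (inj₂ R) = A R

applyState : ∀ {nin arIn naux arAux n} → UpdateProgram nin arIn naux arAux →
  Modification nin arIn n → State nin arIn naux arAux n → State nin arIn naux arAux n
applyState P m@(mod δ S a) 𝒮@(I , A) =
  applyInput m I , (λ R b → eval (P R δ S) (stateDB 𝒮) (a ++ b))

applyStateSeq : ∀ {nin arIn naux arAux n} → UpdateProgram nin arIn naux arAux →
  List (Modification nin arIn n) → State nin arIn naux arAux n → State nin arIn naux arAux n
applyStateSeq P []      𝒮 = 𝒮
applyStateSeq P (m ∷ α) 𝒮 = applyStateSeq P α (applyState P m 𝒮)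

record DynProgram (nin : ℕ) (arIn : Fin nin → ℕ) (naux : ℕ) (arAux : Fin naux → ℕ) : Set where
  field
    P    : UpdateProgram nin arIn naux arAux
    Init : ∀ n → Database (Fin nin) arIn n → Database (Fin naux) arAux n
    Q    : Fin naux

Maintains : ∀ {nin arIn naux arAux k} → DynProgram nin arIn naux arAux → Query nin arIn k → Set
Maintains {nin} {arIn} {naux} {arAux} {k} prog 𝒬 =
  Σ (arAux (DynProgram.Q prog) ≡ k) λ e →
    ∀ n (𝒟 : Database (Fin nin) arIn n) (α : List (Modification nin arIn n)) (b : Vec (Fin n) k) →
      𝒬 n (applyInputSeq α 𝒟) b
        ≡ Data.Product.proj₂ (applyStateSeq (DynProgram.P prog) α (𝒟 , DynProgram.Init prog n 𝒟))
            (DynProgram.Q prog) (subst (Vec (Fin n)) (Relation.Binary.PropositionalEquality.sym e) b)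

InDyn : FormulaClass → ∀ {nin arIn k} → Query nin arIn k → Set
InDyn 𝒞 {nin} {arIn} 𝒬 =
  Σ ℕ λ naux → Σ (Fin naux → ℕ) λ arAux → Σ (DynProgram nin arIn naux arAux) λ prog →
    (∀ R δ S → 𝒞 (DynProgram.P prog R δ S)) × Maintains prog 𝒬

-- Write 0 and 1 for the first two elements of the domain. For every relation s of a DynFO
-- program (input or auxiliary) the FO∧ program keeps χₛ(c, x̄), "c is the truth value of s(x̄)", together
-- with static gadget relations for the constants, ¬, ∧, ∨, ≤ and = on truth values. An FO formula φ
-- then becomes an FO∧ formula stating that c is the truth value of φ: the values of subformulas are
-- guessed existentially and related by gadgets, and ∃y φ (∀y φ) says that c is the maximum (minimum)
-- of the values of φ, that is ∃y val(φ(y)) = c ∧ ∀z ∃e (val(φ(z)) = e ∧ e ≤ c). Translating the old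
-- update formulas updates the χ relations. The query relation Q must be stored as is, so for every
-- modification kind δ_S the program also keeps "Q holds after δ_S(ū)", updated by substituting the old
-- update formulas into the one for Q; Q is then updated by a single atom.
-- A domain with fewer than two elements has no two truth values, but there the whole state is a bit
-- vector on which δ_S acts by a fixed map F. The program keeps, for every Boolean function f on bit
-- vectors, a 0-ary relation holding f of the current vector; it is updated by the atom for f ∘ F.

module Submission where

open import Defs
open import Data.Nat using (ℕ; zero; suc; _+_; _*_)
open import Data.Fin using (Fin; zero; suc; toℕ; _↑ˡ_; _↑ʳ_; splitAt; combine; remQuot) renaming (_≟_ to _≟ᶠ_)
open import Data.Fin.Properties using (splitAt-↑ˡ; splitAt-↑ʳ; remQuot-combine)
open import Data.Vec using (Vec; []; _∷_; lookup; map; _++_; tabulate; replicate)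
import Data.Vec as Vec
import Data.Vec.Properties as Vecₚ
open import Data.List using ([]; _∷_; allFin)
import Data.List as List
import Data.List.Properties as Listₚ
open import Data.Bool.ListAction using (any; all; or)
open import Data.Bool using (Bool; true; false; _∧_; _∨_; not; if_then_else_)
open import Data.Bool.Properties using (∧-comm; ∧-assoc; ∧-identityʳ; ∧-zeroʳ; ∨-identityʳ; ∨-zeroʳ)
open import Data.Sum using (_⊎_; inj₁; inj₂)
open import Data.Product using (Σ; _×_; _,_; proj₁; proj₂)
open import Data.Unit using (⊤; tt)
open import Data.Empty using (⊥)
open import Function using (_∘_)
open import Relation.Nullary using (yes; no)
open import Relation.Nullary.Decidable using (⌊_⌋; isYes≗does)
open import Relation.Binary.PropositionalEquality

module _ {A : Set} where

  any-cong : ∀ {p q : A → Bool} → p ≗ q → ∀ xs → any p xs ≡ any q xs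
  any-cong p≗q xs = cong or (Listₚ.map-cong p≗q xs)

  all-cong : ∀ {p q : A → Bool} → p ≗ q → ∀ xs → all p xs ≡ all q xs
  all-cong p≗q []       = refl
  all-cong p≗q (x ∷ xs) = cong₂ _∧_ (p≗q x) (all-cong p≗q xs)

  any-false : ∀ {p : A → Bool} → (∀ x → p x ≡ false) → ∀ xs → any p xs ≡ false
  any-false p≡false []       = refl
  any-false p≡false (x ∷ xs) rewrite p≡false x = any-false p≡false xs

  any-false-tabulate : ∀ {n} {p : A → Bool} (f : Fin n → A) → (∀ i → p (f i) ≡ false) →
    any p (List.tabulate f) ≡ false
  any-false-tabulate {zero}  f h = refl
  any-false-tabulate {suc n} f h rewrite h zero = any-false-tabulate (f ∘ suc) (h ∘ suc)

  all-true : ∀ {p : A → Bool} → (∀ x → p x ≡ true) → ∀ xs → all p xs ≡ true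
  all-true p≡true []       = refl
  all-true p≡true (x ∷ xs) rewrite p≡true x = all-true p≡true xs

  any-∧ˡ : ∀ k (p : A → Bool) xs → any (λ x → k ∧ p x) xs ≡ k ∧ any p xs
  any-∧ˡ true  p xs = refl
  any-∧ˡ false p xs = any-false (λ _ → refl) xs

  any-∧ʳ : ∀ (p : A → Bool) k xs → any (λ x → p x ∧ k) xs ≡ any p xs ∧ k
  any-∧ʳ p k xs = begin
    any (λ x → p x ∧ k) xs ≡⟨ any-cong (λ x → ∧-comm (p x) k) xs ⟩
    any (λ x → k ∧ p x) xs ≡⟨ any-∧ˡ k p xs ⟩
    k ∧ any p xs           ≡⟨ ∧-comm k _ ⟩
    any p xs ∧ k           ∎
    where open ≡-Reasoning

  all-not : ∀ (p : A → Bool) xs → all (not ∘ p) xs ≡ not (any p xs)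
  all-not p []       = refl
  all-not p (x ∷ xs) with p x
  ... | true  = refl
  ... | false = all-not p xs

  any-not : ∀ (p : A → Bool) xs → any (not ∘ p) xs ≡ not (all p xs)
  any-not p []       = refl
  any-not p (x ∷ xs) with p x
  ... | true  = any-not p xs
  ... | false = refl

module _ {n : ℕ} where

  all-const : ∀ b → all (λ (_ : Fin (suc n)) → b) (allFin (suc n)) ≡ b
  all-const true  = all-true (λ _ → refl) (allFin (suc n))
  all-const false = refl

  all-∧ˡ : ∀ k (p : Fin (suc n) → Bool) → all (λ y → k ∧ p y) (allFin (suc n)) ≡ k ∧ all p (allFin (suc n))
  all-∧ˡ true  p = refl
  all-∧ˡ false p = refl

  all-∧ʳ : ∀ (p : Fin (suc n) → Bool) k → all (λ y → p y ∧ k) (allFin (suc n)) ≡ all p (allFin (suc n)) ∧ k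
  all-∧ʳ p k = begin
    all (λ y → p y ∧ k) (allFin (suc n)) ≡⟨ all-cong (λ y → ∧-comm (p y) k) (allFin (suc n)) ⟩
    all (λ y → k ∧ p y) (allFin (suc n)) ≡⟨ all-∧ˡ k p ⟩
    k ∧ all p (allFin (suc n))           ≡⟨ ∧-comm k _ ⟩
    all p (allFin (suc n)) ∧ k           ∎
    where open ≡-Reasoning

  any∧all : ∀ (p : Fin (suc n) → Bool) → any p (allFin (suc n)) ∧ all p (allFin (suc n)) ≡ all p (allFin (suc n))
  any∧all p with p zero
  ... | true  = refl
  ... | false = ∧-zeroʳ _

lift : ∀ {v w} → (Fin v → Fin w) → Fin (suc v) → Fin (suc w)
lift ρ zero    = zero
lift ρ (suc i) = suc (ρ i)

weaken : ∀ {v w} → (Fin v → Fin w) → Fin v → Fin (suc w)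
weaken ρ i = suc (ρ i)

lookup-lift : ∀ {n v w} {ρ : Fin v → Fin w} {env : Vec (Fin n) w} {env′ : Vec (Fin n) v} d →
  lookup env ∘ ρ ≗ lookup env′ → lookup (d ∷ env) ∘ lift ρ ≗ lookup (d ∷ env′)
lookup-lift d h zero    = refl
lookup-lift d h (suc i) = h i

map-lookup : ∀ {n v w} {ρ : Fin v → Fin w} {env : Vec (Fin n) w} {env′ : Vec (Fin n) v} →
  lookup env ∘ ρ ≗ lookup env′ → ∀ {k} (xs : Vec (Fin v) k) → map (lookup env) (map ρ xs) ≡ map (lookup env′) xs
map-lookup {ρ = ρ} {env} h xs = trans (sym (Vecₚ.map-∘ (lookup env) ρ xs)) (Vecₚ.map-cong h xs)

module _ {Sym : Set} {ar : Sym → ℕ} where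

  rename : ∀ {v w} → (Fin v → Fin w) → Formula Sym ar v → Formula Sym ar w
  rename ρ (rel R xs) = rel R (map ρ xs)
  rename ρ (eq x y)   = eq (ρ x) (ρ y)
  rename ρ tt         = tt
  rename ρ ff         = ff
  rename ρ (neg φ)    = neg (rename ρ φ)
  rename ρ (conj φ ψ) = conj (rename ρ φ) (rename ρ ψ)
  rename ρ (disj φ ψ) = disj (rename ρ φ) (rename ρ ψ)
  rename ρ (ex φ)     = ex (rename (lift ρ) φ)
  rename ρ (fa φ)     = fa (rename (lift ρ) φ)

  eval-rename : ∀ {n v w} (φ : Formula Sym ar v) {ρ : Fin v → Fin w} (D : Database Sym ar n) {env env′} →
    lookup env ∘ ρ ≗ lookup env′ → eval (rename ρ φ) D env ≡ eval φ D env′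
  eval-rename (rel R xs) D {env} {env′} h = cong (D R) (map-lookup {env = env} {env′} h xs)
  eval-rename (eq x y)   D h = cong₂ (λ a b → ⌊ a ≟ᶠ b ⌋) (h x) (h y)
  eval-rename tt         D h = refl
  eval-rename ff         D h = refl
  eval-rename (neg φ)    D h = cong not (eval-rename φ D h)
  eval-rename (conj φ ψ) D h = cong₂ _∧_ (eval-rename φ D h) (eval-rename ψ D h)
  eval-rename (disj φ ψ) D h = cong₂ _∨_ (eval-rename φ D h) (eval-rename ψ D h)
  eval-rename {n} (ex φ) D h = any-cong (λ d → eval-rename φ D (lookup-lift d h)) (allFin n)
  eval-rename {n} (fa φ) D h = all-cong (λ d → eval-rename φ D (lookup-lift d h)) (allFin n)

  eval-weaken : ∀ {n v} (φ : Formula Sym ar v) (D : Database Sym ar n) d env →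
    eval (rename suc φ) D (d ∷ env) ≡ eval φ D env
  eval-weaken φ D d env = eval-rename φ D (λ _ → refl)

  eval-cong-db : ∀ {n v} (φ : Formula Sym ar v) {D D′ : Database Sym ar n} →
    (∀ s t → D s t ≡ D′ s t) → ∀ env → eval φ D env ≡ eval φ D′ env
  eval-cong-db (rel R xs) h env = h R _
  eval-cong-db (eq x y)   h env = refl
  eval-cong-db tt         h env = refl
  eval-cong-db ff         h env = refl
  eval-cong-db (neg φ)    h env = cong not (eval-cong-db φ h env)
  eval-cong-db (conj φ ψ) h env = cong₂ _∧_ (eval-cong-db φ h env) (eval-cong-db ψ h env)
  eval-cong-db (disj φ ψ) h env = cong₂ _∨_ (eval-cong-db φ h env) (eval-cong-db ψ h env)
  eval-cong-db {n} (ex φ) h env = any-cong (λ d → eval-cong-db φ h (d ∷ env)) (allFin n)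
  eval-cong-db {n} (fa φ) h env = all-cong (λ d → eval-cong-db φ h (d ∷ env)) (allFin n)

  definedDB : ∀ {n p} → ((s : Sym) → Formula Sym ar (p + ar s)) → Database Sym ar n → Vec (Fin n) p →
    Database Sym ar n
  definedDB σ D a s t = eval (σ s) D (a ++ t)

  substRel : ∀ {p v w} (σ : (s : Sym) → Formula Sym ar (p + ar s)) (u : Vec (Fin w) p) (ρ : Fin v → Fin w) →
    Formula Sym ar v → Formula Sym ar w
  substRel σ u ρ (rel s xs) = rename (lookup (u ++ map ρ xs)) (σ s)
  substRel σ u ρ (eq x y)   = eq (ρ x) (ρ y)
  substRel σ u ρ tt         = tt
  substRel σ u ρ ff         = ff
  substRel σ u ρ (neg φ)    = neg (substRel σ u ρ φ)
  substRel σ u ρ (conj φ ψ) = conj (substRel σ u ρ φ) (substRel σ u ρ ψ)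
  substRel σ u ρ (disj φ ψ) = disj (substRel σ u ρ φ) (substRel σ u ρ ψ)
  substRel σ u ρ (ex φ)     = ex (substRel σ (map suc u) (lift ρ) φ)
  substRel σ u ρ (fa φ)     = fa (substRel σ (map suc u) (lift ρ) φ)

  eval-substRel : ∀ {n p v w} (φ : Formula Sym ar v) (σ : (s : Sym) → Formula Sym ar (p + ar s))
    {u : Vec (Fin w) p} {ρ : Fin v → Fin w} (D : Database Sym ar n) {env env′ a} →
    lookup env ∘ ρ ≗ lookup env′ → map (lookup env) u ≡ a →
    eval (substRel σ u ρ φ) D env ≡ eval φ (definedDB σ D a) env′
  eval-substRel (rel s xs) σ {u} {ρ} D {env} {env′} {a} h hu = eval-rename (σ s) D λ i →
    trans (sym (Vecₚ.lookup-map i (lookup env) (u ++ map ρ xs))) (cong (λ w → lookup w i) lookups)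
    where lookups : map (lookup env) (u ++ map ρ xs) ≡ a ++ map (lookup env′) xs
          lookups = trans (Vecₚ.map-++ (lookup env) u (map ρ xs))
                          (cong₂ _++_ hu (map-lookup {env = env} {env′} h xs))
  eval-substRel (eq x y)   σ D h hu = cong₂ (λ a b → ⌊ a ≟ᶠ b ⌋) (h x) (h y)
  eval-substRel tt         σ D h hu = refl
  eval-substRel ff         σ D h hu = refl
  eval-substRel (neg φ)    σ D h hu = cong not (eval-substRel φ σ D h hu)
  eval-substRel (conj φ ψ) σ D h hu = cong₂ _∧_ (eval-substRel φ σ D h hu) (eval-substRel ψ σ D h hu)
  eval-substRel (disj φ ψ) σ D h hu = cong₂ _∨_ (eval-substRel φ σ D h hu) (eval-substRel ψ σ D h hu)
  eval-substRel {n} (ex φ) σ {u} D h hu =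
    any-cong (λ d → eval-substRel φ σ D (lookup-lift d h) (trans (sym (Vecₚ.map-∘ _ suc u)) hu)) (allFin n)
  eval-substRel {n} (fa φ) σ {u} D h hu =
    all-cong (λ d → eval-substRel φ σ D (lookup-lift d h) (trans (sym (Vecₚ.map-∘ _ suc u)) hu)) (allFin n)

  eqs : ∀ {v k} → Vec (Fin v) k → Vec (Fin v) k → Formula Sym ar v
  eqs []       []       = tt
  eqs (x ∷ xs) (y ∷ ys) = conj (eq x y) (eqs xs ys)

  eval-eqs : ∀ {n v k} (xs ys : Vec (Fin v) k) (D : Database Sym ar n) env →
    eval (eqs xs ys) D env ≡ ⌊ map (lookup env) xs ≟ᵛ map (lookup env) ys ⌋
  eval-eqs []       []       D env = refl
  eval-eqs (x ∷ xs) (y ∷ ys) D env =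
    trans (cong (⌊ lookup env x ≟ᶠ lookup env y ⌋ ∧_) (eval-eqs xs ys D env))
      (trans (cong₂ _∧_ (isYes≗does (lookup env x ≟ᶠ lookup env y))
                        (isYes≗does (map (lookup env) xs ≟ᵛ map (lookup env) ys)))
             (sym (isYes≗does (map (lookup env) (x ∷ xs) ≟ᵛ map (lookup env) (y ∷ ys)))))

FO∧Formula : (Sym : Set) → (Sym → ℕ) → ℕ → Set
FO∧Formula Sym ar v = Σ (Formula Sym ar v) FOConj

module _ {Sym : Set} {ar : Sym → ℕ} where

  rename-IsAtom : ∀ {v w} {φ : Formula Sym ar v} (ρ : Fin v → Fin w) → IsAtom φ → IsAtom (rename ρ φ)
  rename-IsAtom ρ (rel-atom R xs) = rel-atom R _
  rename-IsAtom ρ (eq-atom x y)   = eq-atom _ _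

  rename-IsConjOfAtoms : ∀ {v w} {φ : Formula Sym ar v} (ρ : Fin v → Fin w) →
    IsConjOfAtoms φ → IsConjOfAtoms (rename ρ φ)
  rename-IsConjOfAtoms ρ (atom a)  = atom (rename-IsAtom ρ a)
  rename-IsConjOfAtoms ρ (and a b) = and (rename-IsConjOfAtoms ρ a) (rename-IsConjOfAtoms ρ b)

  rename-FOConj : ∀ {v w} {φ : Formula Sym ar v} (ρ : Fin v → Fin w) → FOConj φ → FOConj (rename ρ φ)
  rename-FOConj ρ (matrix a) = matrix (rename-IsConjOfAtoms ρ a)
  rename-FOConj ρ (ex-pre p) = ex-pre (rename-FOConj (lift ρ) p)
  rename-FOConj ρ (fa-pre p) = fa-pre (rename-FOConj (lift ρ) p)

  _∧ᵐ_ : ∀ {v} {φ ψ : Formula Sym ar v} → IsConjOfAtoms φ → FOConj ψ → Formula Sym ar v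
  _∧ᵐ_ {φ = φ} {ψ} a (matrix b) = conj φ ψ
  a ∧ᵐ ex-pre q = ex (rename-IsConjOfAtoms suc a ∧ᵐ q)
  a ∧ᵐ fa-pre q = fa (rename-IsConjOfAtoms suc a ∧ᵐ q)

  _∧ᵖ_ : ∀ {v} {φ ψ : Formula Sym ar v} → FOConj φ → FOConj ψ → Formula Sym ar v
  matrix a ∧ᵖ q = a ∧ᵐ q
  ex-pre p ∧ᵖ q = ex (p ∧ᵖ rename-FOConj suc q)
  fa-pre p ∧ᵖ q = fa (p ∧ᵖ rename-FOConj suc q)

  ∧ᵐ-FOConj : ∀ {v} {φ ψ : Formula Sym ar v} (a : IsConjOfAtoms φ) (q : FOConj ψ) → FOConj (a ∧ᵐ q)
  ∧ᵐ-FOConj a (matrix b) = matrix (and a b)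
  ∧ᵐ-FOConj a (ex-pre q) = ex-pre (∧ᵐ-FOConj (rename-IsConjOfAtoms suc a) q)
  ∧ᵐ-FOConj a (fa-pre q) = fa-pre (∧ᵐ-FOConj (rename-IsConjOfAtoms suc a) q)

  ∧ᵖ-FOConj : ∀ {v} {φ ψ : Formula Sym ar v} (p : FOConj φ) (q : FOConj ψ) → FOConj (p ∧ᵖ q)
  ∧ᵖ-FOConj (matrix a) q = ∧ᵐ-FOConj a q
  ∧ᵖ-FOConj (ex-pre p) q = ex-pre (∧ᵖ-FOConj p (rename-FOConj suc q))
  ∧ᵖ-FOConj (fa-pre p) q = fa-pre (∧ᵖ-FOConj p (rename-FOConj suc q))

  -- Pulling a universal quantifier out of a conjunction needs a non-empty domain.
  eval-∧ᵐ : ∀ {n v} {φ ψ : Formula Sym ar v} (a : IsConjOfAtoms φ) (q : FOConj ψ)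
    (D : Database Sym ar (suc n)) env → eval (a ∧ᵐ q) D env ≡ eval φ D env ∧ eval ψ D env
  eval-∧ᵐ a (matrix b) D env = refl
  eval-∧ᵐ {n} {φ = φ} {ex ψ} a (ex-pre q) D env =
    trans (any-cong (λ d → trans (eval-∧ᵐ (rename-IsConjOfAtoms suc a) q D (d ∷ env))
                                 (cong (_∧ eval ψ D (d ∷ env)) (eval-weaken φ D d env))) (allFin (suc n)))
          (any-∧ˡ (eval φ D env) _ (allFin (suc n)))
  eval-∧ᵐ {n} {φ = φ} {fa ψ} a (fa-pre q) D env =
    trans (all-cong (λ d → trans (eval-∧ᵐ (rename-IsConjOfAtoms suc a) q D (d ∷ env))
                                 (cong (_∧ eval ψ D (d ∷ env)) (eval-weaken φ D d env))) (allFin (suc n)))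
          (all-∧ˡ (eval φ D env) (λ d → eval ψ D (d ∷ env)))

  eval-∧ᵖ : ∀ {n v} {φ ψ : Formula Sym ar v} (p : FOConj φ) (q : FOConj ψ)
    (D : Database Sym ar (suc n)) env → eval (p ∧ᵖ q) D env ≡ eval φ D env ∧ eval ψ D env
  eval-∧ᵖ (matrix a) q D env = eval-∧ᵐ a q D env
  eval-∧ᵖ {n} {φ = ex φ} {ψ} (ex-pre p) q D env =
    trans (any-cong (λ d → trans (eval-∧ᵖ p (rename-FOConj suc q) D (d ∷ env))
                                 (cong (eval φ D (d ∷ env) ∧_) (eval-weaken ψ D d env))) (allFin (suc n)))
          (any-∧ʳ _ (eval ψ D env) (allFin (suc n)))
  eval-∧ᵖ {n} {φ = fa φ} {ψ} (fa-pre p) q D env =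
    trans (all-cong (λ d → trans (eval-∧ᵖ p (rename-FOConj suc q) D (d ∷ env))
                                 (cong (eval φ D (d ∷ env) ∧_) (eval-weaken ψ D d env))) (allFin (suc n)))
          (all-∧ʳ (λ d → eval φ D (d ∷ env)) (eval ψ D env))

  -- True on the empty domain, equivalent to φ on every other one.
  faVacuous : ∀ {v} → Formula Sym ar v → Formula Sym ar v
  faVacuous φ = fa (rename suc φ)

  faVacuous-FOConj : ∀ {v} {φ : Formula Sym ar v} → FOConj φ → FOConj (faVacuous φ)
  faVacuous-FOConj p = fa-pre (rename-FOConj suc p)

  eval-faVacuous : ∀ {n v} (φ : Formula Sym ar v) (D : Database Sym ar (suc n)) env →
    eval (faVacuous φ) D env ≡ eval φ D env
  eval-faVacuous {n} φ D env =
    trans (all-cong (λ d → eval-weaken φ D d env) (allFin (suc n))) (all-const {n} (eval φ D env))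

  Positive : (Sym → Set) → ∀ {v} → Formula Sym ar v → Set
  Positive G (rel R xs) = G R
  Positive G (eq x y)   = ⊤
  Positive G tt         = ⊤
  Positive G ff         = ⊥
  Positive G (neg φ)    = ⊥
  Positive G (conj φ ψ) = Positive G φ × Positive G ψ
  Positive G (disj φ ψ) = ⊥
  Positive G (ex φ)     = Positive G φ
  Positive G (fa φ)     = Positive G φ

  rename-Positive : ∀ G {v w} (ρ : Fin v → Fin w) (φ : Formula Sym ar v) → Positive G φ → Positive G (rename ρ φ)
  rename-Positive G ρ (rel R xs) g       = g
  rename-Positive G ρ (eq x y)   g       = tt
  rename-Positive G ρ tt         g       = tt
  rename-Positive G ρ (conj φ ψ) (g , h) = rename-Positive G ρ φ g , rename-Positive G ρ ψ h
  rename-Positive G ρ (ex φ)     g       = rename-Positive G (lift ρ) φ g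
  rename-Positive G ρ (fa φ)     g       = rename-Positive G (lift ρ) φ g

  ∧ᵐ-Positive : ∀ G {v} {φ ψ : Formula Sym ar v} (a : IsConjOfAtoms φ) (q : FOConj ψ) →
    Positive G φ → Positive G ψ → Positive G (a ∧ᵐ q)
  ∧ᵐ-Positive G a (matrix b) g h = g , h
  ∧ᵐ-Positive G {φ = φ} a (ex-pre q) g h =
    ∧ᵐ-Positive G (rename-IsConjOfAtoms suc a) q (rename-Positive G suc φ g) h
  ∧ᵐ-Positive G {φ = φ} a (fa-pre q) g h =
    ∧ᵐ-Positive G (rename-IsConjOfAtoms suc a) q (rename-Positive G suc φ g) h

  ∧ᵖ-Positive : ∀ G {v} {φ ψ : Formula Sym ar v} (p : FOConj φ) (q : FOConj ψ) →
    Positive G φ → Positive G ψ → Positive G (p ∧ᵖ q)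
  ∧ᵖ-Positive G (matrix a) q g h = ∧ᵐ-Positive G a q g h
  ∧ᵖ-Positive G {ψ = ψ} (ex-pre p) q g h = ∧ᵖ-Positive G p (rename-FOConj suc q) g (rename-Positive G suc ψ h)
  ∧ᵖ-Positive G {ψ = ψ} (fa-pre p) q g h = ∧ᵖ-Positive G p (rename-FOConj suc q) g (rename-Positive G suc ψ h)

  Positive-true : ∀ G {v} (φ : Formula Sym ar v) (D : Database Sym ar 1) →
    (∀ s t → G s → D s t ≡ true) → Positive G φ → ∀ env → eval φ D env ≡ true
  Positive-true G (rel R xs) D full g env = full R _ g
  Positive-true G (eq x y)   D full g env with lookup env x | lookup env y
  ... | zero | zero = refl
  Positive-true G tt         D full g env = refl
  Positive-true G (conj φ ψ) D full (g , h) env =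
    cong₂ _∧_ (Positive-true G φ D full g env) (Positive-true G ψ D full h env)
  Positive-true G (ex φ)     D full g env = cong (_∨ false) (Positive-true G φ D full g (zero ∷ env))
  Positive-true G (fa φ)     D full g env = cong (_∧ true) (Positive-true G φ D full g (zero ∷ env))

reindex : ∀ {Sym : Set} {ar : Sym → ℕ} {n k} → Database Sym ar n → (x : Sym) → ar x ≡ k → Rel n k
reindex D x p ts = D x (subst (Vec _) (sym p) ts)

module _ {Sym : Set} {ar : Sym → ℕ} where

  atomₚ : ∀ {w k} (x : Sym) → ar x ≡ k → Vec (Fin w) k → FO∧Formula Sym ar w
  atomₚ x p xs = rel x (subst (Vec _) (sym p) xs) , matrix (atom (rel-atom _ _))

  eval-atomₚ : ∀ {n w k} (x : Sym) (p : ar x ≡ k) (xs : Vec (Fin w) k) (D : Database Sym ar n) env →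
    eval (proj₁ (atomₚ x p xs)) D env ≡ reindex D x p (map (lookup env) xs)
  eval-atomₚ x refl xs D env = refl

  _∧ₚ_ : ∀ {w} → FO∧Formula Sym ar w → FO∧Formula Sym ar w → FO∧Formula Sym ar w
  (φ , p) ∧ₚ (ψ , q) = p ∧ᵖ q , ∧ᵖ-FOConj p q

  ∃ₚ : ∀ {w} → FO∧Formula Sym ar (suc w) → FO∧Formula Sym ar w
  ∃ₚ (φ , p) = ex φ , ex-pre p

  ∀ₚ : ∀ {w} → FO∧Formula Sym ar (suc w) → FO∧Formula Sym ar w
  ∀ₚ (φ , p) = fa φ , fa-pre p

  faVacuousₚ : ∀ {w} → FO∧Formula Sym ar w → FO∧Formula Sym ar w
  faVacuousₚ (φ , p) = faVacuous φ , faVacuous-FOConj p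

  eval-∧ₚ : ∀ {n w} (φ ψ : FO∧Formula Sym ar w) (D : Database Sym ar (suc n)) env →
    eval (proj₁ (φ ∧ₚ ψ)) D env ≡ eval (proj₁ φ) D env ∧ eval (proj₁ ψ) D env
  eval-∧ₚ (φ , p) (ψ , q) = eval-∧ᵖ p q

  ∧ₚ-Positive : ∀ G {w} (φ ψ : FO∧Formula Sym ar w) →
    Positive G (proj₁ φ) → Positive G (proj₁ ψ) → Positive G (proj₁ (φ ∧ₚ ψ))
  ∧ₚ-Positive G (φ , p) (ψ , q) = ∧ᵖ-Positive G p q

-- Truth values and gadgets

module _ {m : ℕ} where

  -- The first two elements of a domain with at least two elements serve as the truth values.
  isBit : Fin (suc (suc m)) → Bool → Bool
  isBit zero          b = not b
  isBit (suc zero)    b = b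
  isBit (suc (suc _)) b = false

  bit : Bool → Fin (suc (suc m))
  bit false = zero
  bit true  = suc zero

  isBit-true : ∀ b → isBit (bit b) true ≡ b
  isBit-true false = refl
  isBit-true true  = refl

  any-isBit : ∀ b (g : Fin (suc (suc m)) → Bool) → any (λ d → isBit d b ∧ g d) (allFin (suc (suc m))) ≡ g (bit b)
  any-isBit b g =
    trans (cong (λ r → isBit zero b ∧ g zero ∨ (isBit (suc zero) b ∧ g (suc zero) ∨ r)) rest-false) (first-two b)
    where
      rest-false : any (λ d → isBit d b ∧ g d) (List.tabulate (λ (i : Fin m) → suc (suc i))) ≡ false
      rest-false = any-false-tabulate {p = λ d → isBit d b ∧ g d} (λ i → suc (suc i)) (λ _ → refl)
      first-two : ∀ b → isBit zero b ∧ g zero ∨ (isBit (suc zero) b ∧ g (suc zero) ∨ false) ≡ g (bit b)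
      first-two false = ∨-identityʳ _
      first-two true  = ∨-identityʳ _

data BinOp : Set where
  ∧ᵒ ∨ᵒ : BinOp

⟦_⟧ᵒ : BinOp → Bool → Bool → Bool
⟦ ∧ᵒ ⟧ᵒ = _∧_
⟦ ∨ᵒ ⟧ᵒ = _∨_

data Gadget : Set where
  bitᵍ : Bool → Gadget
  notᵍ : Gadget
  binᵍ : BinOp → Gadget
  ≤ᵍ   : Gadget
  ≡ᵍ   : Gadget

gadgetArity : Gadget → ℕ
gadgetArity (bitᵍ _) = 1
gadgetArity notᵍ     = 2
gadgetArity (binᵍ _) = 3
gadgetArity ≤ᵍ       = 2
gadgetArity ≡ᵍ       = 3

anyBool : (Bool → Bool) → Bool
anyBool f = f false ∨ f true

⟦_⟧ᵍ : ∀ {m} (g : Gadget) → Vec (Fin (suc (suc m))) (gadgetArity g) → Bool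
⟦ bitᵍ b ⟧ᵍ (c ∷ [])           = isBit c b
⟦ notᵍ ⟧ᵍ   (d ∷ c ∷ [])       = anyBool λ b → isBit d b ∧ isBit c (not b)
⟦ binᵍ o ⟧ᵍ (d₁ ∷ d₂ ∷ c ∷ []) =
  anyBool λ b₁ → anyBool λ b₂ → isBit d₁ b₁ ∧ (isBit d₂ b₂ ∧ isBit c (⟦ o ⟧ᵒ b₁ b₂))
⟦ ≤ᵍ ⟧ᵍ     (d ∷ c ∷ [])       =
  anyBool λ b₁ → anyBool λ b₂ → isBit d b₁ ∧ (isBit c b₂ ∧ (not b₁ ∨ b₂))
⟦ ≡ᵍ ⟧ᵍ     (x ∷ y ∷ c ∷ [])   = isBit c ⌊ x ≟ᶠ y ⌋

module _ {m : ℕ} where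

  ⟦notᵍ⟧-bit : ∀ b (c : Fin (suc (suc m))) → ⟦ notᵍ ⟧ᵍ (bit b ∷ c ∷ []) ≡ isBit c (not b)
  ⟦notᵍ⟧-bit false c = ∨-identityʳ _
  ⟦notᵍ⟧-bit true  c = refl

  ⟦binᵍ⟧-bit : ∀ o b₁ b₂ (c : Fin (suc (suc m))) →
    ⟦ binᵍ o ⟧ᵍ (bit b₁ ∷ bit b₂ ∷ c ∷ []) ≡ isBit c (⟦ o ⟧ᵒ b₁ b₂)
  ⟦binᵍ⟧-bit o false false c = trans (∨-identityʳ _) (∨-identityʳ _)
  ⟦binᵍ⟧-bit o false true  c = ∨-identityʳ _
  ⟦binᵍ⟧-bit o true  false c = ∨-identityʳ _
  ⟦binᵍ⟧-bit o true  true  c = refl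

data Extremum : Set where
  maximum minimum : Extremum

boundedBy : ∀ {A : Set} → Extremum → A → A → Vec A 2
boundedBy maximum e c = e ∷ c ∷ []
boundedBy minimum e c = c ∷ e ∷ []

map-boundedBy : ∀ {A B : Set} (f : A → B) E e c → map f (boundedBy E e c) ≡ boundedBy E (f e) (f c)
map-boundedBy f maximum e c = refl
map-boundedBy f minimum e c = refl

extremum : ∀ {n} → Extremum → (Fin n → Bool) → Bool
extremum {n} maximum f = any f (allFin n)
extremum {n} minimum f = all f (allFin n)

isBit-extremum : ∀ {m} E (c : Fin (suc (suc m))) (f : Fin (suc (suc m)) → Bool) →
  let xs = allFin (suc (suc m)) in
  any (λ y → isBit c (f y) ∧ all (λ z → ⟦ ≤ᵍ ⟧ᵍ (boundedBy E (bit (f z)) c)) xs) xs ≡ isBit c (extremum E f)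
isBit-extremum {m} maximum zero f =
  trans (any-∧ʳ (not ∘ f) _ xs)
    (trans (cong (any (not ∘ f) xs ∧_) (all-cong (λ z → ≤-false (f z)) xs))
      (trans (any∧all (not ∘ f)) (all-not f xs)))
  where xs = allFin (suc (suc m))
        ≤-false : ∀ b → ⟦ ≤ᵍ ⟧ᵍ (bit {m} b ∷ zero ∷ []) ≡ not b
        ≤-false false = refl
        ≤-false true  = refl
isBit-extremum {m} maximum (suc zero) f =
  trans (any-cong (λ y → cong (f y ∧_) (all-true (λ z → ≤-true (f z)) xs)) xs) (any-cong (∧-identityʳ ∘ f) xs)
  where xs = allFin (suc (suc m))
        ≤-true : ∀ b → ⟦ ≤ᵍ ⟧ᵍ (bit {m} b ∷ suc zero ∷ []) ≡ true
        ≤-true false = refl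
        ≤-true true  = refl
isBit-extremum {m} minimum zero f =
  trans (any-cong (λ y → cong (not (f y) ∧_) (all-true (λ z → false≤ (f z)) xs)) xs)
    (trans (any-cong (∧-identityʳ ∘ not ∘ f) xs) (any-not f xs))
  where xs = allFin (suc (suc m))
        false≤ : ∀ b → ⟦ ≤ᵍ ⟧ᵍ (zero ∷ bit {m} b ∷ []) ≡ true
        false≤ false = refl
        false≤ true  = refl
isBit-extremum {m} minimum (suc zero) f =
  trans (any-∧ʳ f _ xs) (trans (cong (any f xs ∧_) (all-cong (λ z → true≤ (f z)) xs)) (any∧all f))
  where xs = allFin (suc (suc m))
        true≤ : ∀ b → ⟦ ≤ᵍ ⟧ᵍ (suc zero ∷ bit {m} b ∷ []) ≡ b
        true≤ false = refl
        true≤ true  = refl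
isBit-extremum {m} E (suc (suc c)) f = any-false (λ _ → refl) (allFin (suc (suc m)))

-- Translating FO into FO∧

module Translation {Sym : Set} {ar : Sym → ℕ} {Sym′ : Set} {ar′ : Sym′ → ℕ}
  (χ : Sym → Sym′) (χ-arity : ∀ s → ar′ (χ s) ≡ suc (ar s))
  (γ : Gadget → Sym′) (γ-arity : ∀ g → ar′ (γ g) ≡ gadgetArity g) where

  gadget : ∀ {w} (g : Gadget) → Vec (Fin w) (gadgetArity g) → FO∧Formula Sym′ ar′ w
  gadget g = atomₚ (γ g) (γ-arity g)

  tr : ∀ {v w} → (Fin v → Fin w) → Fin w → Formula Sym ar v → FO∧Formula Sym′ ar′ w
  trBin : ∀ {v w} → BinOp → (Fin v → Fin w) → Fin w → (φ ψ : Formula Sym ar v) → FO∧Formula Sym′ ar′ w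
  trExtremum : ∀ {v w} → Extremum → (Fin v → Fin w) → Fin w → Formula Sym ar (suc v) → FO∧Formula Sym′ ar′ w

  tr ρ c (rel s xs) = atomₚ (χ s) (χ-arity s) (c ∷ map ρ xs)
  tr ρ c (eq x y)   = gadget ≡ᵍ (ρ x ∷ ρ y ∷ c ∷ [])
  tr ρ c tt         = gadget (bitᵍ true) (c ∷ [])
  tr ρ c ff         = gadget (bitᵍ false) (c ∷ [])
  tr ρ c (neg φ)    = ∃ₚ (tr (weaken ρ) zero φ ∧ₚ gadget notᵍ (zero ∷ suc c ∷ []))
  tr ρ c (conj φ ψ) = trBin ∧ᵒ ρ c φ ψ
  tr ρ c (disj φ ψ) = trBin ∨ᵒ ρ c φ ψ
  tr ρ c (ex φ)     = trExtremum maximum ρ c φ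
  tr ρ c (fa φ)     = trExtremum minimum ρ c φ

  trBin o ρ c φ ψ =
    ∃ₚ (∃ₚ ((tr (weaken (weaken ρ)) (suc zero) φ ∧ₚ tr (weaken (weaken ρ)) zero ψ)
            ∧ₚ gadget (binᵍ o) (suc zero ∷ zero ∷ suc (suc c) ∷ [])))

  trExtremum E ρ c φ =
    ∃ₚ (tr (lift ρ) (suc c) φ
        ∧ₚ ∀ₚ (∃ₚ (tr (weaken (lift (weaken ρ))) zero φ ∧ₚ gadget ≤ᵍ (boundedBy E zero (suc (suc (suc c)))))))

  trHolds : ∀ {v} → Formula Sym ar v → FO∧Formula Sym′ ar′ v
  trHolds φ = ∃ₚ (tr (λ i → suc i) zero φ ∧ₚ gadget (bitᵍ true) (zero ∷ []))

  module _ {m : ℕ} {D : Database Sym ar (suc (suc m))} {D′ : Database Sym′ ar′ (suc (suc m))}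
    (χ-sem : ∀ s c t → reindex D′ (χ s) (χ-arity s) (c ∷ t) ≡ isBit c (D s t))
    (γ-sem : ∀ g ts → reindex D′ (γ g) (γ-arity g) ts ≡ ⟦ g ⟧ᵍ ts) where

    private
      xs = allFin (suc (suc m))

    eval-gadget : ∀ {w} g (ys : Vec (Fin w) (gadgetArity g)) env →
      eval (proj₁ (gadget g ys)) D′ env ≡ ⟦ g ⟧ᵍ (map (lookup env) ys)
    eval-gadget g ys env = trans (eval-atomₚ (γ g) (γ-arity g) ys D′ env) (γ-sem g _)

    eval-tr : ∀ {v w} (φ : Formula Sym ar v) {ρ : Fin v → Fin w} c {env env′} →
      lookup env ∘ ρ ≗ lookup env′ → eval (proj₁ (tr ρ c φ)) D′ env ≡ isBit (lookup env c) (eval φ D env′)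

    eval-trBin : ∀ {v w} o (φ ψ : Formula Sym ar v) {ρ : Fin v → Fin w} c {env env′} →
      lookup env ∘ ρ ≗ lookup env′ →
      eval (proj₁ (trBin o ρ c φ ψ)) D′ env ≡ isBit (lookup env c) (⟦ o ⟧ᵒ (eval φ D env′) (eval ψ D env′))

    eval-trExtremum : ∀ {v w} E (φ : Formula Sym ar (suc v)) {ρ : Fin v → Fin w} c {env env′} →
      lookup env ∘ ρ ≗ lookup env′ →
      eval (proj₁ (trExtremum E ρ c φ)) D′ env ≡ isBit (lookup env c) (extremum E (λ d → eval φ D (d ∷ env′)))

    eval-tr (rel s ys) {ρ} c {env} {env′} h =
      trans (eval-atomₚ (χ s) (χ-arity s) (c ∷ map ρ ys) D′ env)
        (trans (χ-sem s (lookup env c) _)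
               (cong (isBit (lookup env c) ∘ D s) (map-lookup {env = env} {env′} h ys)))
    eval-tr (eq x y) c {env} h =
      trans (eval-gadget ≡ᵍ _ env) (cong₂ (λ a b → isBit (lookup env c) ⌊ a ≟ᶠ b ⌋) (h x) (h y))
    eval-tr tt c {env} h = eval-gadget (bitᵍ true) _ env
    eval-tr ff c {env} h = eval-gadget (bitᵍ false) _ env
    eval-tr (neg φ) {ρ} c {env} {env′} h = begin
      any (λ d → eval (proj₁ (tr (weaken ρ) zero φ ∧ₚ gadget notᵍ (zero ∷ suc c ∷ []))) D′ (d ∷ env)) xs
        ≡⟨ any-cong (λ d → trans (eval-∧ₚ (tr (weaken ρ) zero φ) (gadget notᵍ _) D′ (d ∷ env))
                                 (cong₂ _∧_ (eval-tr φ zero h) (eval-gadget notᵍ _ (d ∷ env)))) xs ⟩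
      any (λ d → isBit d β ∧ ⟦ notᵍ ⟧ᵍ (d ∷ lookup env c ∷ [])) xs
        ≡⟨ any-isBit β (λ d → ⟦ notᵍ ⟧ᵍ (d ∷ lookup env c ∷ [])) ⟩
      ⟦ notᵍ ⟧ᵍ (bit β ∷ lookup env c ∷ [])
        ≡⟨ ⟦notᵍ⟧-bit β (lookup env c) ⟩
      isBit (lookup env c) (not β) ∎
      where open ≡-Reasoning
            β = eval φ D env′
    eval-tr (conj φ ψ) c h = eval-trBin ∧ᵒ φ ψ c h
    eval-tr (disj φ ψ) c h = eval-trBin ∨ᵒ φ ψ c h
    eval-tr (ex φ)     c h = eval-trExtremum maximum φ c h
    eval-tr (fa φ)     c h = eval-trExtremum minimum φ c h

    eval-trBin o φ ψ {ρ} c {env} {env′} h = begin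
      any (λ d₁ → any (λ d₂ → eval (proj₁ ((A ∧ₚ B) ∧ₚ gate)) D′ (d₂ ∷ d₁ ∷ env)) xs) xs
        ≡⟨ any-cong (λ d₁ → any-cong (λ d₂ → unfold d₁ d₂) xs) xs ⟩
      any (λ d₁ → any (λ d₂ → isBit d₁ β₁ ∧ (isBit d₂ β₂ ∧ ⟦ binᵍ o ⟧ᵍ (d₁ ∷ d₂ ∷ c′ ∷ []))) xs) xs
        ≡⟨ any-cong (λ d₁ → trans (any-∧ˡ (isBit d₁ β₁) _ xs)
             (cong (isBit d₁ β₁ ∧_) (any-isBit β₂ (λ d₂ → ⟦ binᵍ o ⟧ᵍ (d₁ ∷ d₂ ∷ c′ ∷ []))))) xs ⟩
      any (λ d₁ → isBit d₁ β₁ ∧ ⟦ binᵍ o ⟧ᵍ (d₁ ∷ bit β₂ ∷ c′ ∷ [])) xs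
        ≡⟨ any-isBit β₁ (λ d₁ → ⟦ binᵍ o ⟧ᵍ (d₁ ∷ bit β₂ ∷ c′ ∷ [])) ⟩
      ⟦ binᵍ o ⟧ᵍ (bit β₁ ∷ bit β₂ ∷ c′ ∷ [])
        ≡⟨ ⟦binᵍ⟧-bit o β₁ β₂ c′ ⟩
      isBit c′ (⟦ o ⟧ᵒ β₁ β₂) ∎
      where
        open ≡-Reasoning
        A = tr (weaken (weaken ρ)) (suc zero) φ
        B = tr (weaken (weaken ρ)) zero ψ
        gate = gadget (binᵍ o) (suc zero ∷ zero ∷ suc (suc c) ∷ [])
        β₁ = eval φ D env′
        β₂ = eval ψ D env′
        c′ = lookup env c
        unfold : ∀ d₁ d₂ → eval (proj₁ ((A ∧ₚ B) ∧ₚ gate)) D′ (d₂ ∷ d₁ ∷ env)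
                         ≡ isBit d₁ β₁ ∧ (isBit d₂ β₂ ∧ ⟦ binᵍ o ⟧ᵍ (d₁ ∷ d₂ ∷ c′ ∷ []))
        unfold d₁ d₂ = begin
          eval (proj₁ ((A ∧ₚ B) ∧ₚ gate)) D′ env₂
            ≡⟨ eval-∧ₚ (A ∧ₚ B) gate D′ env₂ ⟩
          eval (proj₁ (A ∧ₚ B)) D′ env₂ ∧ eval (proj₁ gate) D′ env₂
            ≡⟨ cong₂ _∧_ (trans (eval-∧ₚ A B D′ env₂) (cong₂ _∧_ (eval-tr φ (suc zero) h) (eval-tr ψ zero h)))
                         (eval-gadget (binᵍ o) _ env₂) ⟩
          (isBit d₁ β₁ ∧ isBit d₂ β₂) ∧ ⟦ binᵍ o ⟧ᵍ (d₁ ∷ d₂ ∷ c′ ∷ [])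
            ≡⟨ ∧-assoc (isBit d₁ β₁) _ _ ⟩
          isBit d₁ β₁ ∧ (isBit d₂ β₂ ∧ ⟦ binᵍ o ⟧ᵍ (d₁ ∷ d₂ ∷ c′ ∷ [])) ∎
          where env₂ = d₂ ∷ d₁ ∷ env

    eval-trExtremum E φ {ρ} c {env} {env′} h = begin
      any (λ y → eval (proj₁ (A ∧ₚ ∀ₚ (∃ₚ (B ∧ₚ bound)))) D′ (y ∷ env)) xs
        ≡⟨ any-cong (λ y → trans (eval-∧ₚ A (∀ₚ (∃ₚ (B ∧ₚ bound))) D′ (y ∷ env))
                                 (cong₂ _∧_ (eval-tr φ (suc c) (lookup-lift y h)) (all-cong (bounded y) xs))) xs ⟩
      any (λ y → isBit c′ (f y) ∧ all (λ z → ⟦ ≤ᵍ ⟧ᵍ (boundedBy E (bit (f z)) c′)) xs) xs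
        ≡⟨ isBit-extremum E c′ f ⟩
      isBit c′ (extremum E f) ∎
      where
        open ≡-Reasoning
        A = tr (lift ρ) (suc c) φ
        B = tr (weaken (lift (weaken ρ))) zero φ
        bound = gadget ≤ᵍ (boundedBy E zero (suc (suc (suc c))))
        f = λ d → eval φ D (d ∷ env′)
        c′ = lookup env c
        bounded : ∀ y z →
          eval (proj₁ (∃ₚ (B ∧ₚ bound))) D′ (z ∷ y ∷ env) ≡ ⟦ ≤ᵍ ⟧ᵍ (boundedBy E (bit (f z)) c′)
        bounded y z =
          trans (any-cong (λ e → trans (eval-∧ₚ B bound D′ (e ∷ z ∷ y ∷ env))
                   (cong₂ _∧_ (eval-tr φ zero (lookup-lift z h))
                              (trans (eval-gadget ≤ᵍ _ (e ∷ z ∷ y ∷ env))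
                                     (cong ⟦ ≤ᵍ ⟧ᵍ (map-boundedBy (lookup (e ∷ z ∷ y ∷ env)) E zero _))))) xs)
                (any-isBit (f z) (λ e → ⟦ ≤ᵍ ⟧ᵍ (boundedBy E e c′)))

    eval-trHolds : ∀ {v} (φ : Formula Sym ar v) env → eval (proj₁ (trHolds φ)) D′ env ≡ eval φ D env
    eval-trHolds φ env =
      trans (any-cong (λ c → trans (eval-∧ₚ (tr _ zero φ) (gadget (bitᵍ true) (zero ∷ [])) D′ (c ∷ env))
                                   (cong₂ _∧_ (eval-tr φ zero {env′ = env} (λ _ → refl))
                                              (eval-gadget (bitᵍ true) _ (c ∷ env)))) xs)
            (trans (any-isBit {m} (eval φ D env) (λ c → isBit c true)) (isBit-true (eval φ D env)))

  module _ (G : Sym′ → Set) (G-χ : ∀ s → G (χ s)) (G-γ : ∀ g → G (γ g)) where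

    tr-Positive : ∀ {v w} (φ : Formula Sym ar v) (ρ : Fin v → Fin w) c → Positive G (proj₁ (tr ρ c φ))
    trBin-Positive : ∀ {v w} o (φ ψ : Formula Sym ar v) (ρ : Fin v → Fin w) c → Positive G (proj₁ (trBin o ρ c φ ψ))
    trExtremum-Positive : ∀ {v w} E (φ : Formula Sym ar (suc v)) (ρ : Fin v → Fin w) c →
      Positive G (proj₁ (trExtremum E ρ c φ))

    tr-Positive (rel s xs) ρ c = G-χ s
    tr-Positive (eq x y)   ρ c = G-γ ≡ᵍ
    tr-Positive tt         ρ c = G-γ (bitᵍ true)
    tr-Positive ff         ρ c = G-γ (bitᵍ false)
    tr-Positive (neg φ)    ρ c =
      ∧ₚ-Positive G (tr (weaken ρ) zero φ) (gadget notᵍ _) (tr-Positive φ _ _) (G-γ notᵍ)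
    tr-Positive (conj φ ψ) ρ c = trBin-Positive ∧ᵒ φ ψ ρ c
    tr-Positive (disj φ ψ) ρ c = trBin-Positive ∨ᵒ φ ψ ρ c
    tr-Positive (ex φ)     ρ c = trExtremum-Positive maximum φ ρ c
    tr-Positive (fa φ)     ρ c = trExtremum-Positive minimum φ ρ c

    trBin-Positive o φ ψ ρ c =
      ∧ₚ-Positive G (tr (weaken (weaken ρ)) (suc zero) φ ∧ₚ tr (weaken (weaken ρ)) zero ψ) (gadget (binᵍ o) _)
        (∧ₚ-Positive G (tr _ _ φ) (tr _ _ ψ) (tr-Positive φ _ _) (tr-Positive ψ _ _)) (G-γ (binᵍ o))

    trExtremum-Positive E φ ρ c =
      ∧ₚ-Positive G (tr (lift ρ) (suc c) φ) (∀ₚ (∃ₚ (B ∧ₚ gadget ≤ᵍ _))) (tr-Positive φ _ _)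
        (∧ₚ-Positive G B (gadget ≤ᵍ _) (tr-Positive φ _ _) (G-γ ≤ᵍ))
      where B = tr (weaken (lift (weaken ρ))) zero φ

    trHolds-Positive : ∀ {v} (φ : Formula Sym ar v) → Positive G (proj₁ (trHolds φ))
    trHolds-Positive φ =
      ∧ₚ-Positive G (tr _ zero φ) (gadget (bitᵍ true) (zero ∷ [])) (tr-Positive φ _ zero) (G-γ (bitᵍ true))

-- Finite codes

record FinCode (A : Set) : Set where
  field
    size          : ℕ
    encode        : A → Fin size
    decode        : Fin size → A
    decode-encode : ∀ x → decode (encode x) ≡ x

open FinCode public

Fin-code : ∀ n → FinCode (Fin n)
Fin-code n = record { size = n ; encode = λ i → i ; decode = λ i → i ; decode-encode = λ _ → refl }

Bool-code : FinCode Bool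
Bool-code = record { size = 2 ; encode = enc ; decode = dec ; decode-encode = λ { false → refl ; true → refl } }
  where enc : Bool → Fin 2
        enc false = zero
        enc true  = suc zero
        dec : Fin 2 → Bool
        dec zero    = false
        dec (suc _) = true

retract : ∀ {A B : Set} (to : B → A) (from : A → B) → (∀ b → from (to b) ≡ b) → FinCode A → FinCode B
retract to from from-to CA = record
  { size = size CA ; encode = encode CA ∘ to ; decode = from ∘ decode CA
  ; decode-encode = λ b → trans (cong from (decode-encode CA (to b))) (from-to b) }

module _ {A B : Set} (CA : FinCode A) (CB : FinCode B) where

  ⊎-code : FinCode (A ⊎ B)
  ⊎-code = record { size = size CA + size CB ; encode = enc ; decode = dec ; decode-encode = dec-enc }
    where
      enc : A ⊎ B → Fin (size CA + size CB)
      enc (inj₁ x) = encode CA x ↑ˡ size CB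
      enc (inj₂ y) = size CA ↑ʳ encode CB y
      dec′ : Fin (size CA) ⊎ Fin (size CB) → A ⊎ B
      dec′ (inj₁ i) = inj₁ (decode CA i)
      dec′ (inj₂ j) = inj₂ (decode CB j)
      dec : Fin (size CA + size CB) → A ⊎ B
      dec = dec′ ∘ splitAt (size CA)
      dec-enc : ∀ x → dec (enc x) ≡ x
      dec-enc (inj₁ x) rewrite splitAt-↑ˡ (size CA) (encode CA x) (size CB) = cong inj₁ (decode-encode CA x)
      dec-enc (inj₂ y) rewrite splitAt-↑ʳ (size CA) (size CB) (encode CB y) = cong inj₂ (decode-encode CB y)

  ×-code : FinCode (A × B)
  ×-code = record { size = size CA * size CB ; encode = enc ; decode = dec ; decode-encode = dec-enc }
    where
      enc : A × B → Fin (size CA * size CB)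
      enc (x , y) = combine (encode CA x) (encode CB y)
      dec′ : Fin (size CA) × Fin (size CB) → A × B
      dec′ (i , j) = decode CA i , decode CB j
      dec : Fin (size CA * size CB) → A × B
      dec = dec′ ∘ remQuot (size CB)
      dec-enc : ∀ p → dec (enc p) ≡ p
      dec-enc (x , y) = trans (cong dec′ (remQuot-combine (encode CA x) (encode CB y)))
                              (cong₂ _,_ (decode-encode CA x) (decode-encode CB y))

Vec-code : ∀ {A : Set} → FinCode A → ∀ n → FinCode (Vec A n)
Vec-code CA zero    = record { size = 1 ; encode = λ _ → zero ; decode = λ _ → [] ; decode-encode = λ { [] → refl } }
Vec-code CA (suc n) = retract uncons (λ (x , xs) → x ∷ xs) (λ { (x ∷ xs) → refl }) (×-code CA (Vec-code CA n))
  where uncons : ∀ {A : Set} → Vec A (suc n) → A × Vec A n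
        uncons (x ∷ xs) = x , xs

module _ {A : Set} (CA : FinCode A) where

  table-code : FinCode (Vec Bool (size CA))
  table-code = Vec-code Bool-code (size CA)

  encodeFun : (A → Bool) → Fin (size table-code)
  encodeFun f = encode table-code (tabulate (f ∘ decode CA))

  decodeFun : Fin (size table-code) → A → Bool
  decodeFun i x = lookup (decode table-code i) (encode CA x)

  decodeFun-encodeFun : ∀ f x → decodeFun (encodeFun f) x ≡ f x
  decodeFun-encodeFun f x =
    trans (cong (λ v → lookup v (encode CA x)) (decode-encode table-code _))
      (trans (Vecₚ.lookup∘tabulate _ (encode CA x)) (cong f (decode-encode CA x)))

  encodeFun-cong : ∀ {f g : A → Bool} → f ≗ g → encodeFun f ≡ encodeFun g
  encodeFun-cong f≗g = cong (encode table-code) (Vecₚ.tabulate-cong (f≗g ∘ decode CA))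

leftVars : ∀ p q → Vec (Fin (p + q)) p
leftVars p q = tabulate (_↑ˡ q)

rightVars : ∀ p q → Vec (Fin (p + q)) q
rightVars p q = tabulate (p ↑ʳ_)

skip : ∀ p q → Fin (p + q) → Fin (p + suc q)
skip p q i with splitAt p i
... | inj₁ j = j ↑ˡ suc q
... | inj₂ j = p ↑ʳ suc j

module _ {A : Set} where

  map-lookup-leftVars : ∀ {p q} (a : Vec A p) (t : Vec A q) → map (lookup (a ++ t)) (leftVars p q) ≡ a
  map-lookup-leftVars {p} {q} a t =
    trans (sym (Vecₚ.tabulate-∘ (lookup (a ++ t)) (_↑ˡ q)))
          (trans (Vecₚ.tabulate-cong (Vecₚ.lookup-++ˡ a t)) (Vecₚ.tabulate∘lookup a))

  map-lookup-rightVars : ∀ {p q} (a : Vec A p) (t : Vec A q) → map (lookup (a ++ t)) (rightVars p q) ≡ t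
  map-lookup-rightVars {p} {q} a t =
    trans (sym (Vecₚ.tabulate-∘ (lookup (a ++ t)) (p ↑ʳ_)))
          (trans (Vecₚ.tabulate-cong (Vecₚ.lookup-++ʳ a t)) (Vecₚ.tabulate∘lookup t))

  lookup-skip : ∀ {p q} (a : Vec A p) c (t : Vec A q) → lookup (a ++ (c ∷ t)) ∘ skip p q ≗ lookup (a ++ t)
  lookup-skip {p} a c t i rewrite Vecₚ.lookup-splitAt p a t i with splitAt p i
  ... | inj₁ j = Vecₚ.lookup-++ˡ a (c ∷ t) j
  ... | inj₂ j = Vecₚ.lookup-++ʳ a (c ∷ t) (suc j)

-- Over a domain Fin (toℕ k) with k < 2 a relation contains at most one tuple, so it carries a single bit.
smallValue : ∀ (k : Fin 2) r → Rel (toℕ k) r → Bool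
smallValue zero       zero    R = R []
smallValue zero       (suc r) R = false
smallValue (suc zero) r       R = R (replicate r zero)

smallValue-at : ∀ k r (R : Rel (toℕ k) r) t → smallValue k r R ≡ R t
smallValue-at zero       zero    R []      = refl
smallValue-at zero       (suc r) R (() ∷ t)
smallValue-at (suc zero) r       R t       = cong R (sym (all-zero t))
  where all-zero : ∀ {r} (t : Vec (Fin 1) r) → t ≡ replicate r zero
        all-zero []       = refl
        all-zero (zero ∷ t) = cong (zero ∷_) (all-zero t)

smallValue-cong : ∀ k r {R R′ : Rel (toℕ k) r} → R ≗ R′ → smallValue k r R ≡ smallValue k r R′
smallValue-cong zero       zero    R≗R′ = R≗R′ []
smallValue-cong zero       (suc r) R≗R′ = refl
smallValue-cong (suc zero) r       R≗R′ = R≗R′ _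

smallValue-++ : ∀ k {p} r {R : Rel (toℕ k) r} {R′ : Rel (toℕ k) (p + r)} (a : Vec (Fin (toℕ k)) p) →
  (∀ t → R t ≡ R′ (a ++ t)) → smallValue k r R ≡ smallValue k (p + r) R′
smallValue-++ (suc zero) r {R′ = R′} a h = trans (h _) (sym (smallValue-at (suc zero) _ R′ _))
smallValue-++ zero zero {R′ = R′} a h = trans (h []) (sym (smallValue-at zero _ R′ (a ++ [])))
smallValue-++ zero (suc r) []       h = refl
smallValue-++ zero (suc r) (() ∷ a) h

-- The FO∧ program

module InputUpdates {nin : ℕ} {arIn : Fin nin → ℕ} {naux : ℕ} {arAux : Fin naux → ℕ} where

  inputUpdate : ModKind → (S S′ : Fin nin) → Formula (TauSym nin naux) (tauAr arIn arAux) (arIn S + arIn S′)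
  inputUpdate δ S S′ with S′ ≟ᶠ S
  inputUpdate ins S .S | yes refl = disj (rel (inj₁ S) (rightVars p p)) (eqs (rightVars p p) (leftVars p p))
    where p = arIn S
  inputUpdate del S .S | yes refl = conj (rel (inj₁ S) (rightVars p p)) (neg (eqs (rightVars p p) (leftVars p p)))
    where p = arIn S
  ... | no _ = rel (inj₁ S′) (rightVars (arIn S) (arIn S′))

  eval-eqs-rightVars-leftVars : ∀ {n} {p} (D : Database (TauSym nin naux) (tauAr arIn arAux) n) (a t : Vec (Fin n) p) →
    eval (eqs (rightVars p p) (leftVars p p)) D (a ++ t) ≡ ⌊ t ≟ᵛ a ⌋
  eval-eqs-rightVars-leftVars D a t =
    trans (eval-eqs (rightVars _ _) (leftVars _ _) D (a ++ t))
          (cong₂ (λ x y → ⌊ x ≟ᵛ y ⌋) (map-lookup-rightVars a t) (map-lookup-leftVars a t))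

  eval-inputUpdate : ∀ {n} δ S S′ (I : Database (Fin nin) arIn n) (A : Database (Fin naux) arAux n) a t →
    eval (inputUpdate δ S S′) (stateDB (I , A)) (a ++ t) ≡ applyInput (mod δ S a) I S′ t
  eval-inputUpdate ins S S′ I A a t with S′ ≟ᶠ S
  ... | yes refl =
    trans (cong₂ _∨_ (cong (I S) (map-lookup-rightVars a t)) (eval-eqs-rightVars-leftVars (stateDB (I , A)) a t))
          (or-if (I S t) _)
    where or-if : ∀ x b → x ∨ b ≡ (if b then true else x)
          or-if x true  = ∨-zeroʳ x
          or-if x false = ∨-identityʳ x
  ... | no _ = cong (I S′) (map-lookup-rightVars a t)
  eval-inputUpdate del S S′ I A a t with S′ ≟ᶠ S
  ... | yes refl =
    trans (cong₂ (λ x b → x ∧ not b) (cong (I S) (map-lookup-rightVars a t))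
                                      (eval-eqs-rightVars-leftVars (stateDB (I , A)) a t))
          (and-if (I S t) _)
    where and-if : ∀ x b → x ∧ not b ≡ (if b then false else x)
          and-if x true  = ∧-zeroʳ x
          and-if x false = ∧-identityʳ x
  ... | no _ = cong (I S′) (map-lookup-rightVars a t)

ModKind-code : FinCode ModKind
ModKind-code = retract to from (λ { ins → refl ; del → refl }) Bool-code
  where to : ModKind → Bool
        to ins = true
        to del = false
        from : Bool → ModKind
        from true  = ins
        from false = del

Gadget-code : FinCode Gadget
Gadget-code = retract to from from-to (Fin-code 7)
  where
    to : Gadget → Fin 7
    to (bitᵍ false) = zero
    to (bitᵍ true)  = suc zero
    to notᵍ         = suc (suc zero)
    to (binᵍ ∧ᵒ)    = suc (suc (suc zero))
    to (binᵍ ∨ᵒ)    = suc (suc (suc (suc zero)))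
    to ≤ᵍ           = suc (suc (suc (suc (suc zero))))
    to ≡ᵍ           = suc (suc (suc (suc (suc (suc zero)))))
    from : Fin 7 → Gadget
    from zero                                   = bitᵍ false
    from (suc zero)                             = bitᵍ true
    from (suc (suc zero))                       = notᵍ
    from (suc (suc (suc zero)))                 = binᵍ ∧ᵒ
    from (suc (suc (suc (suc zero))))           = binᵍ ∨ᵒ
    from (suc (suc (suc (suc (suc zero)))))     = ≤ᵍ
    from (suc (suc (suc (suc (suc (suc _)))))) = ≡ᵍ
    from-to : ∀ g → from (to g) ≡ g
    from-to (bitᵍ false) = refl
    from-to (bitᵍ true)  = refl
    from-to notᵍ         = refl
    from-to (binᵍ ∧ᵒ)    = refl
    from-to (binᵍ ∨ᵒ)    = refl
    from-to ≤ᵍ           = refl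
    from-to ≡ᵍ           = refl

module Construction {nin : ℕ} {arIn : Fin nin → ℕ} {naux : ℕ} {arAux : Fin naux → ℕ}
  (prog : DynProgram nin arIn naux arAux) where

  open DynProgram prog
  open InputUpdates {nin} {arIn} {naux} {arAux}

  τ : Set
  τ = TauSym nin naux

  tar : τ → ℕ
  tar = tauAr arIn arAux

  St : ℕ → Set
  St = State nin arIn naux arAux

  updateFormula : ModKind → (S : Fin nin) → (s : τ) → Formula τ tar (arIn S + tar s)
  updateFormula δ S (inj₁ S′) = inputUpdate δ S S′
  updateFormula δ S (inj₂ R)  = P R δ S

  stateDB-applyState : ∀ {n} δ S a (I : Database (Fin nin) arIn n) A sy t →
    stateDB (applyState P (mod δ S a) (I , A)) sy t ≡ definedDB (updateFormula δ S) (stateDB (I , A)) a sy t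
  stateDB-applyState δ S a I A (inj₁ S′) t = sym (eval-inputUpdate δ S S′ I A a t)
  stateDB-applyState δ S a I A (inj₂ R)  t = refl

  τ-code : FinCode τ
  τ-code = ⊎-code (Fin-code nin) (Fin-code naux)

  Bits : Set
  Bits = τ → Bool

  nBits : ℕ
  nBits = size (table-code τ-code)

  code : Bits → Fin nBits
  code = encodeFun τ-code

  data AuxSym : Set where
    χ     : τ → AuxSym
    γ     : Gadget → AuxSym
    after : ModKind → Fin nin → AuxSym
    table : Vec (Vec Bool nBits) 2 → AuxSym
    query : AuxSym

  AuxSym-code : FinCode AuxSym
  AuxSym-code = retract to from from-to
    (⊎-code τ-code (⊎-code Gadget-code (⊎-code (×-code ModKind-code (Fin-code nin))
      (⊎-code (Vec-code (Vec-code Bool-code nBits) 2) (Fin-code 1)))))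
    where
      to : AuxSym → τ ⊎ (Gadget ⊎ ((ModKind × Fin nin) ⊎ (Vec (Vec Bool nBits) 2 ⊎ Fin 1)))
      to (χ s)       = inj₁ s
      to (γ g)       = inj₂ (inj₁ g)
      to (after δ S) = inj₂ (inj₂ (inj₁ (δ , S)))
      to (table fs)  = inj₂ (inj₂ (inj₂ (inj₁ fs)))
      to query       = inj₂ (inj₂ (inj₂ (inj₂ zero)))
      from : τ ⊎ (Gadget ⊎ ((ModKind × Fin nin) ⊎ (Vec (Vec Bool nBits) 2 ⊎ Fin 1))) → AuxSym
      from (inj₁ s)                         = χ s
      from (inj₂ (inj₁ g))                  = γ g
      from (inj₂ (inj₂ (inj₁ (δ , S))))     = after δ S
      from (inj₂ (inj₂ (inj₂ (inj₁ fs))))   = table fs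
      from (inj₂ (inj₂ (inj₂ (inj₂ _))))    = query
      from-to : ∀ x → from (to x) ≡ x
      from-to (χ s)       = refl
      from-to (γ g)       = refl
      from-to (after δ S) = refl
      from-to (table fs)  = refl
      from-to query       = refl

  arity : AuxSym → ℕ
  arity (χ s)       = suc (tar s)
  arity (γ g)       = gadgetArity g
  arity (after δ S) = arIn S + arAux Q
  arity (table _)   = 0
  arity query       = arAux Q

  naux′ : ℕ
  naux′ = size AuxSym-code

  arAux′ : Fin naux′ → ℕ
  arAux′ = arity ∘ decode AuxSym-code

  arity-code : ∀ x → arAux′ (encode AuxSym-code x) ≡ arity x
  arity-code x = cong arity (decode-encode AuxSym-code x)

  τ′ : Set
  τ′ = TauSym nin naux′

  tar′ : τ′ → ℕ
  tar′ = tauAr arIn arAux′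

  auxAtom : ∀ {w} (x : AuxSym) → Vec (Fin w) (arity x) → FO∧Formula τ′ tar′ w
  auxAtom x = atomₚ (inj₂ (encode AuxSym-code x)) (arity-code x)

  open Translation {Sym = τ} {ar = tar} {Sym′ = τ′} {ar′ = tar′}
    (λ s → inj₂ (encode AuxSym-code (χ s))) (λ s → arity-code (χ s))
    (λ g → inj₂ (encode AuxSym-code (γ g))) (λ g → arity-code (γ g))

  bitsOf : ∀ k → St (toℕ k) → Bits
  bitsOf k s sy = smallValue k (tar sy) (stateDB s sy)

  stepBits : Fin 2 → ModKind → Fin nin → Bits → Bits
  stepBits k δ S bits sy = smallValue k (arIn S + tar sy) (eval (updateFormula δ S sy) (λ s _ → bits s))

  stepBits-cong : ∀ k δ S {bits bits′ : Bits} → bits ≗ bits′ → stepBits k δ S bits ≗ stepBits k δ S bits′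
  stepBits-cong k δ S bits≗bits′ sy =
    smallValue-cong k _ (eval-cong-db (updateFormula δ S sy) (λ s _ → bits≗bits′ s))

  bitsOf-applyState : ∀ k δ S a I A → bitsOf k (applyState P (mod δ S a) (I , A)) ≗ stepBits k δ S (bitsOf k (I , A))
  bitsOf-applyState k δ S a I A sy = smallValue-++ k (tar sy) a λ t →
    trans (stateDB-applyState δ S a I A sy t)
          (eval-cong-db (updateFormula δ S sy) (λ s′ → sym ∘ smallValue-at k (tar s′) (stateDB (I , A) s′)) (a ++ t))

  stepTable : Fin 2 → ModKind → Fin nin → Vec Bool nBits → Vec Bool nBits
  stepTable k δ S f = tabulate (λ j → lookup f (code (stepBits k δ S (decodeFun τ-code j))))

  lookup-stepTable : ∀ k δ S f bits → lookup (stepTable k δ S f) (code bits) ≡ lookup f (code (stepBits k δ S bits))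
  lookup-stepTable k δ S f bits =
    trans (Vecₚ.lookup∘tabulate _ (code bits))
          (cong (lookup f) (encodeFun-cong τ-code (stepBits-cong k δ S (decodeFun-encodeFun τ-code bits))))

  queryTable : Fin 2 → ModKind → Fin nin → Vec Bool nBits
  queryTable k δ S = tabulate (λ j → stepBits k δ S (decodeFun τ-code j) (inj₂ Q))

  lookup-queryTable : ∀ k δ S bits → lookup (queryTable k δ S) (code bits) ≡ stepBits k δ S bits (inj₂ Q)
  lookup-queryTable k δ S bits =
    trans (Vecₚ.lookup∘tabulate _ (code bits)) (stepBits-cong k δ S (decodeFun-encodeFun τ-code bits) (inj₂ Q))

  meaningSmall : ∀ k → St (toℕ k) → (x : AuxSym) → Rel (toℕ k) (arity x)
  meaningSmall k s (χ _)       t = true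
  meaningSmall k s (γ _)       t = true
  meaningSmall k s (after _ _) t = true
  meaningSmall k s (table fs)  t = lookup (lookup fs k) (code (bitsOf k s))
  meaningSmall k s query       t = proj₂ s Q t

  meaningLarge : ∀ m → St (suc (suc m)) → (x : AuxSym) → Rel (suc (suc m)) (arity x)
  meaningLarge m s (χ sy)      (c ∷ t) = isBit c (stateDB s sy t)
  meaningLarge m s (γ g)       t       = ⟦ g ⟧ᵍ t
  meaningLarge m s (after δ S) t       = eval (P Q δ S) (stateDB s) t
  meaningLarge m s (table _)   t       = true
  meaningLarge m s query       t       = proj₂ s Q t

  meaning : ∀ n → St n → (x : AuxSym) → Rel n (arity x)
  meaning zero          = meaningSmall zero
  meaning (suc zero)    = meaningSmall (suc zero)
  meaning (suc (suc m)) = meaningLarge m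

  meaning-toℕ : ∀ k s x t → meaning (toℕ k) s x t ≡ meaningSmall k s x t
  meaning-toℕ zero       s x t = refl
  meaning-toℕ (suc zero) s x t = refl

  Represents : ∀ n → St n → Database (Fin naux′) arAux′ n → Set
  Represents n s A′ = ∀ r t → A′ r t ≡ meaning n s (decode AuxSym-code r) t

  reindex-Represents : ∀ {n s A′} → Represents n s A′ → ∀ (I : Database (Fin nin) arIn n) x ts →
    reindex (stateDB (I , A′)) (inj₂ (encode AuxSym-code x)) (arity-code x) ts ≡ meaning n s x ts
  reindex-Represents {n} {s} rep I x ts = trans (rep _ _) (cast (decode-encode AuxSym-code x) ts)
    where cast : ∀ {y x} (y≡x : y ≡ x) ts →
                   meaning n s y (subst (Vec (Fin n)) (sym (cong arity y≡x)) ts) ≡ meaning n s x ts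
          cast refl ts = refl

  eval-auxAtom : ∀ {n s A′} → Represents n s A′ → ∀ I {w} x (xs : Vec (Fin w) (arity x)) env →
    eval (proj₁ (auxAtom x xs)) (stateDB (I , A′)) env ≡ meaning n s x (map (lookup env) xs)
  eval-auxAtom {A′ = A′} rep I x xs env =
    trans (eval-atomₚ (inj₂ (encode AuxSym-code x)) (arity-code x) xs (stateDB (I , A′)) env)
          (reindex-Represents rep I x _)

  afterFormula : ModKind → (S : Fin nin) → ModKind → (S₀ : Fin nin) → Formula τ tar (arIn S + (arIn S₀ + arAux Q))
  afterFormula δ S δ₀ S₀ = substRel (updateFormula δ S) (leftVars (arIn S) _) (arIn S ↑ʳ_) (P Q δ₀ S₀)

  eval-afterFormula : ∀ {n} δ S δ₀ S₀ (I : Database (Fin nin) arIn n) A a t →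
    eval (afterFormula δ S δ₀ S₀) (stateDB (I , A)) (a ++ t)
      ≡ eval (P Q δ₀ S₀) (stateDB (applyState P (mod δ S a) (I , A))) t
  eval-afterFormula δ S δ₀ S₀ I A a t =
    trans (eval-substRel (P Q δ₀ S₀) (updateFormula δ S) (stateDB (I , A)) (Vecₚ.lookup-++ʳ a t) (map-lookup-leftVars a t))
          (eval-cong-db (P Q δ₀ S₀) (λ sy w → sym (stateDB-applyState δ S a I A sy w)) t)

  update : (x : AuxSym) → ModKind → (S : Fin nin) → FO∧Formula τ′ tar′ (arIn S + arity x)
  update (χ sy)        δ S = faVacuousₚ (tr (skip (arIn S) (tar sy)) (arIn S ↑ʳ zero) (updateFormula δ S sy))
  update (γ g)         δ S = auxAtom (γ g) (rightVars (arIn S) (gadgetArity g))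
  update (after δ₀ S₀) δ S = faVacuousₚ (trHolds (afterFormula δ S δ₀ S₀))
  update (table fs)    δ S = auxAtom (table (tabulate λ k → stepTable k δ S (lookup fs k))) []
  update query         δ S = auxAtom (after δ S) (Vec.allFin _) ∧ₚ auxAtom (table (tabulate λ k → queryTable k δ S)) []

  P′ : UpdateProgram nin arIn naux′ arAux′
  P′ r δ S = proj₁ (update (decode AuxSym-code r) δ S)

  prog′ : DynProgram nin arIn naux′ arAux′
  prog′ = record { P = P′ ; Init = λ n I r → meaning n (I , Init n I) (decode AuxSym-code r) ; Q = encode AuxSym-code query }

  P′-FO∧ : ∀ r δ S → FO∧ (P′ r δ S)
  P′-FO∧ r δ S = proj₂ (update (decode AuxSym-code r) δ S)

  module Large {m} {I : Database (Fin nin) arIn (suc (suc m))} {A : Database (Fin naux) arAux (suc (suc m))}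
    {A′ : Database (Fin naux′) arAux′ (suc (suc m))} (rep : Represents (suc (suc m)) (I , A) A′)
    (δ : ModKind) (S : Fin nin) (a : Vec (Fin (suc (suc m))) (arIn S)) where

    private
      χ-sem = λ s c t → reindex-Represents rep I (χ s) (c ∷ t)
      γ-sem = λ g → reindex-Represents rep I (γ g)

    update-meaning : ∀ x t →
      eval (proj₁ (update x δ S)) (stateDB (I , A′)) (a ++ t) ≡ meaningLarge m (applyState P (mod δ S a) (I , A)) x t
    update-meaning (χ sy) (c ∷ t) =
      trans (eval-faVacuous (proj₁ (tr _ _ (updateFormula δ S sy))) (stateDB (I , A′)) (a ++ c ∷ t))
        (trans (eval-tr χ-sem γ-sem (updateFormula δ S sy) (arIn S ↑ʳ zero) (lookup-skip a c t))
               (cong₂ isBit (Vecₚ.lookup-++ʳ a (c ∷ t) zero) (sym (stateDB-applyState δ S a I A sy t))))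
    update-meaning (γ g) t =
      trans (eval-auxAtom rep I (γ g) _ (a ++ t)) (cong ⟦ g ⟧ᵍ (map-lookup-rightVars a t))
    update-meaning (after δ₀ S₀) t =
      trans (eval-faVacuous (proj₁ (trHolds (afterFormula δ S δ₀ S₀))) (stateDB (I , A′)) (a ++ t))
        (trans (eval-trHolds χ-sem γ-sem (afterFormula δ S δ₀ S₀) (a ++ t)) (eval-afterFormula δ S δ₀ S₀ I A a t))
    update-meaning (table fs) t = eval-auxAtom rep I (table _) [] (a ++ t)
    update-meaning query t =
      trans (cong₂ _∧_ (eval-auxAtom rep I (after δ S) (Vec.allFin _) (a ++ t)) (eval-auxAtom rep I (table _) [] (a ++ t)))
        (trans (∧-identityʳ _) (cong (eval (P Q δ S) (stateDB (I , A))) (Vecₚ.map-lookup-allFin (a ++ t))))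

  -- Kept full on domains with fewer than two elements: their update formulas hold there, being vacuously
  -- true on the empty domain and positive on a singleton.
  FullOnSmall : AuxSym → Set
  FullOnSmall (χ _)       = ⊤
  FullOnSmall (γ _)       = ⊤
  FullOnSmall (after _ _) = ⊤
  FullOnSmall (table _)   = ⊥
  FullOnSmall query       = ⊥

  G′ : τ′ → Set
  G′ (inj₁ _) = ⊥
  G′ (inj₂ r) = FullOnSmall (decode AuxSym-code r)

  G′-encode : ∀ x → FullOnSmall x → G′ (inj₂ (encode AuxSym-code x))
  G′-encode x full = subst FullOnSmall (sym (decode-encode AuxSym-code x)) full

  G′-χ : ∀ s → G′ (inj₂ (encode AuxSym-code (χ s)))
  G′-χ s = G′-encode (χ s) tt

  G′-γ : ∀ g → G′ (inj₂ (encode AuxSym-code (γ g)))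
  G′-γ g = G′-encode (γ g) tt

  update-Positive : ∀ x δ S → FullOnSmall x → Positive G′ (proj₁ (update x δ S))
  update-Positive (χ sy) δ S _ =
    rename-Positive G′ suc (proj₁ (tr ρ c (updateFormula δ S sy)))
      (tr-Positive G′ G′-χ G′-γ (updateFormula δ S sy) ρ c)
    where ρ = skip (arIn S) (tar sy)
          c = arIn S ↑ʳ zero
  update-Positive (γ g) δ S _ = G′-γ g
  update-Positive (after δ₀ S₀) δ S _ =
    rename-Positive G′ suc (proj₁ (trHolds (afterFormula δ S δ₀ S₀)))
      (trHolds-Positive G′ G′-χ G′-γ (afterFormula δ S δ₀ S₀))

  meaningSmall-full : ∀ k s x → FullOnSmall x → ∀ t → meaningSmall k s x t ≡ true
  meaningSmall-full k s (χ _)       _ t = refl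
  meaningSmall-full k s (γ _)       _ t = refl
  meaningSmall-full k s (after _ _) _ t = refl

  stateDB-full : ∀ {I : Database (Fin nin) arIn 1} {A A′} → Represents 1 (I , A) A′ →
    ∀ sy t → G′ sy → stateDB (I , A′) sy t ≡ true
  stateDB-full rep (inj₂ r) t full = trans (rep r t) (meaningSmall-full (suc zero) _ (decode AuxSym-code r) full t)

  update-full-small : ∀ (k : Fin 2) {I : Database (Fin nin) arIn (toℕ k)} {A : Database (Fin naux) arAux (toℕ k)}
    {A′ : Database (Fin naux′) arAux′ (toℕ k)} → Represents (toℕ k) (I , A) A′ →
    ∀ δ S (a : Vec (Fin (toℕ k)) (arIn S)) x → FullOnSmall x →
    ∀ t → eval (proj₁ (update x δ S)) (stateDB (I , A′)) (a ++ t) ≡ true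
  update-full-small zero           rep δ S a (χ _)       _ t = refl
  update-full-small zero       {I} rep δ S a (γ g)       _ t = eval-auxAtom rep I (γ g) _ (a ++ t)
  update-full-small zero           rep δ S a (after _ _) _ t = refl
  update-full-small (suc zero) {I} {A′ = A′} rep δ S a x full t =
    Positive-true G′ (proj₁ (update x δ S)) (stateDB (I , A′)) (stateDB-full rep) (update-Positive x δ S full) (a ++ t)

  module Small (k : Fin 2) {I : Database (Fin nin) arIn (toℕ k)} {A : Database (Fin naux) arAux (toℕ k)}
    {A′ : Database (Fin naux′) arAux′ (toℕ k)} (rep : Represents (toℕ k) (I , A) A′)
    (δ : ModKind) (S : Fin nin) (a : Vec (Fin (toℕ k)) (arIn S)) where

    private
      old new : St (toℕ k)
      old = I , A
      new = applyState P (mod δ S a) old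

    update-meaning : ∀ x t → eval (proj₁ (update x δ S)) (stateDB (I , A′)) (a ++ t) ≡ meaningSmall k new x t
    update-meaning (χ sy)        = update-full-small k rep δ S a (χ sy) tt
    update-meaning (γ g)         = update-full-small k rep δ S a (γ g) tt
    update-meaning (after δ₀ S₀) = update-full-small k rep δ S a (after δ₀ S₀) tt
    update-meaning (table fs) [] = begin
      eval (proj₁ (update (table fs) δ S)) (stateDB (I , A′)) (a ++ [])
        ≡⟨ trans (eval-auxAtom rep I (table _) [] (a ++ [])) (meaning-toℕ k _ _ _) ⟩
      lookup (lookup (tabulate λ k′ → stepTable k′ δ S (lookup fs k′)) k) (code (bitsOf k old))
        ≡⟨ cong (λ f → lookup f (code (bitsOf k old)))
                (Vecₚ.lookup∘tabulate (λ k′ → stepTable k′ δ S (lookup fs k′)) k) ⟩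
      lookup (stepTable k δ S (lookup fs k)) (code (bitsOf k old))
        ≡⟨ lookup-stepTable k δ S (lookup fs k) (bitsOf k old) ⟩
      lookup (lookup fs k) (code (stepBits k δ S (bitsOf k old)))
        ≡⟨ cong (lookup (lookup fs k)) (encodeFun-cong τ-code (sym ∘ bitsOf-applyState k δ S a I A)) ⟩
      lookup (lookup fs k) (code (bitsOf k new)) ∎
      where open ≡-Reasoning
    update-meaning query t = begin
      eval (proj₁ (update query δ S)) (stateDB (I , A′)) (a ++ t)
        ≡⟨ cong₂ _∧_ (trans (eval-auxAtom rep I (after δ S) _ (a ++ t)) (meaning-toℕ k _ _ _))
                     (trans (eval-auxAtom rep I (table _) [] (a ++ t)) (meaning-toℕ k _ _ _)) ⟩
      lookup (lookup (tabulate λ k′ → queryTable k′ δ S) k) (code (bitsOf k old))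
        ≡⟨ cong (λ f → lookup f (code (bitsOf k old))) (Vecₚ.lookup∘tabulate (λ k′ → queryTable k′ δ S) k) ⟩
      lookup (queryTable k δ S) (code (bitsOf k old))
        ≡⟨ lookup-queryTable k δ S (bitsOf k old) ⟩
      stepBits k δ S (bitsOf k old) (inj₂ Q)
        ≡⟨ sym (bitsOf-applyState k δ S a I A (inj₂ Q)) ⟩
      bitsOf k new (inj₂ Q)
        ≡⟨ smallValue-at k (arAux Q) _ t ⟩
      proj₂ new Q t ∎
      where open ≡-Reasoning

  step : ∀ n {I A A′} → Represents n (I , A) A′ → ∀ δ S a →
    Represents n (applyState P (mod δ S a) (I , A)) (proj₂ (applyState P′ (mod δ S a) (I , A′)))
  step zero          rep δ S a r = Small.update-meaning zero rep δ S a (decode AuxSym-code r)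
  step (suc zero)    rep δ S a r = Small.update-meaning (suc zero) rep δ S a (decode AuxSym-code r)
  step (suc (suc m)) rep δ S a r = Large.update-meaning rep δ S a (decode AuxSym-code r)

  represents-run : ∀ n α I A A′ → Represents n (I , A) A′ →
    Represents n (applyStateSeq P α (I , A)) (proj₂ (applyStateSeq P′ α (I , A′)))
  represents-run n []              I A A′ rep = rep
  represents-run n (mod δ S a ∷ α) I A A′ rep = represents-run n α _ _ _ (step n rep δ S a)

  meaning-query : ∀ n s t → meaning n s query t ≡ proj₂ s Q t
  meaning-query zero          s t = refl
  meaning-query (suc zero)    s t = refl
  meaning-query (suc (suc m)) s t = refl

  maintains : ∀ {k} (𝒬 : Query nin arIn k) → Maintains prog 𝒬 → Maintains prog′ 𝒬
  maintains 𝒬 (e , H) = trans (arity-code query) e , λ n I α b → trans (H n I α b) (sym (begin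
    A′ n I α (encode AuxSym-code query) (subst (Vec (Fin n)) (sym (trans (arity-code query) e)) b)
      ≡⟨ cong (A′ n I α (encode AuxSym-code query)) (subst-sym-trans (arity-code query) e b) ⟩
    reindex (stateDB (applyStateSeq P′ α (I , DynProgram.Init prog′ n I))) (inj₂ (encode AuxSym-code query))
      (arity-code query) (subst (Vec (Fin n)) (sym e) b)
      ≡⟨ reindex-Represents (represents-run n α I (Init n I) (DynProgram.Init prog′ n I) (λ _ _ → refl))
                              (proj₁ (applyStateSeq P′ α (I , DynProgram.Init prog′ n I))) query _ ⟩
    meaning n (applyStateSeq P α (I , Init n I)) query (subst (Vec (Fin n)) (sym e) b)
      ≡⟨ meaning-query n _ _ ⟩
    proj₂ (applyStateSeq P α (I , Init n I)) Q (subst (Vec (Fin n)) (sym e) b) ∎))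
    where
      open ≡-Reasoning
      A′ : ∀ n I α → Database (Fin naux′) arAux′ n
      A′ n I α = proj₂ (applyStateSeq P′ α (I , DynProgram.Init prog′ n I))
      subst-sym-trans : ∀ {n x y z} (p : x ≡ y) (q : y ≡ z) (v : Vec (Fin n) z) →
        subst (Vec (Fin n)) (sym (trans p q)) v ≡ subst (Vec (Fin n)) (sym p) (subst (Vec (Fin n)) (sym q) v)
      subst-sym-trans refl refl v = refl

DynFO⊆DynFO∧ : ∀ {nin arIn k} (𝒬 : Query nin arIn k) → InDyn FO 𝒬 → InDyn FO∧ 𝒬
DynFO⊆DynFO∧ 𝒬 (naux , arAux , prog , _ , maintains-𝒬) =
  naux′ , arAux′ , prog′ , P′-FO∧ , maintains 𝒬 maintains-𝒬
  where open Construction prog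

DynFO∧⊆DynFO : ∀ {nin arIn k} (𝒬 : Query nin arIn k) → InDyn FO∧ 𝒬 → InDyn FO 𝒬
DynFO∧⊆DynFO 𝒬 (naux , arAux , prog , _ , maintains-𝒬) = naux , arAux , prog , (λ _ _ _ → tt) , maintains-𝒬

theorem3p3 : ∀ (nin : ℕ) (arIn : Fin nin → ℕ) (k : ℕ) (𝒬 : Query nin arIn k) →
    (InDyn FO 𝒬 → InDyn FO∧ 𝒬) × (InDyn FO∧ 𝒬 → InDyn FO 𝒬)
theorem3p3 nin arIn k 𝒬 = DynFO⊆DynFO∧ 𝒬 , DynFO∧⊆DynFO 𝒬
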